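{- Let $k\ge 3$ and let $A=[a_{ij}]$ be an $m\times n$ $(0,1)$-matrix which is maximal $k12\cdots(k-1)$-avoiding and has $a_{1n}=0$. Then the $0$'s in the upper right corner of $A$ form a reverse Ferrers array bordered by a complete L-R zigzag path of $m+n-1$ $1$'s; that is, there is a sequence of $m+n-1$ positions from $(1,1)$ to $(m,n)$, each step moving one position to the right or one position down, such that every position on it contains a $1$, and every position of $A$ lying above this path (i.e. in the upper right region cut off by the path) contains a $0$.
   Context: An $m\times n$ $(0,1)$-matrix $A=[a_{ij}]$ is $k12\cdots(k-1)$-avoiding if there do not exist rows $i_1<i_2<\cdots<i_k$ and columns $j_1<j_2<\cdots<j_k$ with $a_{i_1j_k}=1$ and $a_{i_rj_{r-1}}=1$ for $r=2,\dots,k$ (the pattern of the permutation matrix of $k,1,2,\dots,k-1$, whose first row has its $1$ in the last column). $A$ is maximal $k12\cdots(k-1)$-avoiding if it is $k12\cdots(k-1)$-avoiding and every matrix obtained from $A$ by replacing a $0$ with a $1$ is not $k12\cdots(k-1)$-avoiding. A reverse Ferrers array in the upper right corner is a set of positions such that whenever $(i,j)$ is in it so are $(i',j')$ for all $i'\le i$, $j'\ge j$. -}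

module Defs where

open import Data.Nat using (ℕ; zero; suc; _+_)
open import Data.Fin using (Fin; zero; suc; toℕ; fromℕ; inject₁; _<_; _≟_)
open import Data.Bool using (Bool; true; false; if_then_else_; _∧_)
open import Data.Product using (Σ; ∃; _×_; _,_; proj₁; proj₂)
open import Data.Sum using (_⊎_)
open import Relation.Nullary using (¬_)
open import Relation.Nullary.Decidable using (⌊_⌋)
open import Relation.Binary.PropositionalEquality using (_≡_)

-- An m × n (0,1)-matrix: entries are Booleans (true = 1, false = 0).
-- Rows and columns are 0-indexed via Fin.
Matrix : ℕ → ℕ → Set
Matrix m n = Fin m → Fin n → Bool

StrictlyIncreasing : ∀ {k m} → (Fin k → Fin m) → Set
StrictlyIncreasing {k} f = ∀ (r s : Fin k) → r < s → f r < f s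

-- Column pattern of the permutation k 1 2 ... (k-1) (0-indexed, size suc k'):
-- row 0 has its 1 in the last column, row r+1 has its 1 in column r.
patCol : ∀ {k'} → Fin (suc k') → Fin (suc k')
patCol {k'} zero = fromℕ k'
patCol (suc r) = inject₁ r

-- A contains the pattern k12...(k-1) (with k = suc k').
ContainsPat : ∀ {m n} → (k' : ℕ) → Matrix m n → Set
ContainsPat {m} {n} k' A =
  Σ (Fin (suc k') → Fin m) λ rows →
  Σ (Fin (suc k') → Fin n) λ cols →
    StrictlyIncreasing rows × StrictlyIncreasing cols ×
    (∀ (r : Fin (suc k')) → A (rows r) (cols (patCol r)) ≡ true)

Avoiding : ∀ {m n} → (k' : ℕ) → Matrix m n → Set
Avoiding k' A = ¬ ContainsPat k' A

setOne : ∀ {m n} → Matrix m n → Fin m → Fin n → Matrix m n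
setOne A i j i' j' = if ⌊ i' ≟ i ⌋ ∧ ⌊ j' ≟ j ⌋ then true else A i' j'

MaximalAvoiding : ∀ {m n} → (k' : ℕ) → Matrix m n → Set
MaximalAvoiding k' A =
  Avoiding k' A ×
  (∀ i j → A i j ≡ false → ¬ Avoiding k' (setOne A i j))

-- A complete L-R zigzag path in an (suc m') × (suc n') matrix:
-- m + n - 1 = suc (m' + n') positions from (1,1) to (m,n), each step
-- one position right or one position down.
Path : ℕ → ℕ → Set
Path m' n' = Fin (suc (m' + n')) → Fin (suc m') × Fin (suc n')

IsZigzag : ∀ {m' n'} → Path m' n' → Set
IsZigzag {m'} {n'} p =
  p zero ≡ (zero , zero) ×
  p (fromℕ (m' + n')) ≡ (fromℕ m' , fromℕ n') ×
  (∀ (t : Fin (m' + n')) →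
     let (i , j) = p (inject₁ t) ; (i' , j') = p (suc t) in
     (toℕ i' ≡ toℕ i × toℕ j' ≡ suc (toℕ j)) ⊎
     (toℕ i' ≡ suc (toℕ i) × toℕ j' ≡ toℕ j))

-- Position (i,j) lies above the path (in the upper right region cut off by it):
-- every path position in row i is strictly to the left of column j.
AbovePath : ∀ {m' n'} → Path m' n' → Fin (suc m') → Fin (suc n') → Set
AbovePath {m'} {n'} p i j =
  ∀ (t : Fin (suc (m' + n'))) → proj₁ (p t) ≡ i → proj₂ (p t) < j

module Submission where

-- Let A be maximal k12⋯(k-1)-avoiding with k ≥ 2.  The heart of the argument is a
-- FILLING PROPERTY: if every entry strictly north-east of (i,j) is 0, and either
-- A has a 1 weakly north-east of (i,j), or j is the first column, or i is the last
-- row, then a_ij = 1.  Indeed, were a_ij = 0, turning it into a 1 would create an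
-- occurrence of the pattern; the new 1 cannot be a non-corner entry (the corner
-- would then be a 1 strictly north-east of it), so it is the corner, and the
-- corner can be moved to the 1 weakly north-east, giving an occurrence in A.
--
-- Given the filling property we walk greedily from (0,0): step right while the
-- rows up to the current one still contain a 1 further right, otherwise step
-- down.  Every visited cell is a 1 with only 0's strictly north-east of it; every
-- down-step certifies that the rest of its row to the right is 0; the walk makes
-- m+n-2 moves and ends at (m-1,n-1).  A position above the path lies to the right
-- of the cell where the walk leaves its row, which is found by a discrete
-- intermediate value argument, so it is a 0.

open import Defs
open import Data.Nat using (ℕ; zero; suc; _+_; _≤_; _<_; z≤n; s≤s; s≤s⁻¹; _<?_; _≤?_)
open import Data.Nat.Properties
  using (≤-refl; ≤-reflexive; ≤-trans; ≤-antisym; <-≤-trans; ≤-<-trans; <⇒≤; <⇒≢; <⇒≱; ≮⇒≥;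
         <-irrefl; n<1+n; n≤1+n; 1+n≢n; m<n⇒m<1+n; +-suc; +-cancelˡ-≡; +-mono-<-≤)
import Data.Fin as F
open import Data.Fin using (Fin; zero; suc; toℕ; fromℕ; fromℕ<; inject₁; _≟_)
open import Data.Fin.Properties
  using (toℕ-injective; toℕ<n; toℕ≤pred[n]; toℕ-fromℕ; toℕ-fromℕ<; toℕ-inject₁;
         fromℕ≢inject₁; inject₁ℕ<; any?)
open import Data.Vec.Functional using (_∷_; tail; updateAt)
open import Data.Vec.Functional.Properties using (updateAt-updates; updateAt-minimal)
import Data.Bool as Bool
open import Data.Bool using (true; false)
open import Data.Bool.Properties using (¬-not; not-¬)
open import Data.Product using (Σ; _×_; _,_; proj₁; proj₂)
open import Data.Sum using (_⊎_; inj₁; inj₂; [_,_])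
open import Data.Empty using (⊥-elim)
open import Function using (id; const)
open import Relation.Nullary using (¬_; Dec; yes; no)
open import Relation.Nullary.Decidable using (_×-dec_)
open import Relation.Binary.PropositionalEquality
  using (_≡_; refl; sym; trans; cong; cong₂; subst; subst₂)

up-crossing : (f : ℕ → ℕ) → (∀ t → f (suc t) ≡ f t ⊎ f (suc t) ≡ suc (f t)) →
  ∀ N x → f 0 ≤ x → x < f N →
  Σ ℕ λ u → u < N × f u ≡ x × f (suc u) ≡ suc x
up-crossing f steps zero x f0≤x x<f0 = ⊥-elim (<⇒≱ x<f0 f0≤x)
up-crossing f steps (suc N) x f0≤x x<fN+1 with x <? f N
... | yes x<fN =
  let (u , u<N , fu≡x , up) = up-crossing f steps N x f0≤x x<fN
  in u , m<n⇒m<1+n u<N , fu≡x , up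
... | no x≮fN with steps N
...   | inj₁ flat = ⊥-elim (x≮fN (subst (x <_) flat x<fN+1))
...   | inj₂ up = N , n<1+n N , fN≡x , trans up (cong suc fN≡x)
  where
  fN≡x : f N ≡ x
  fN≡x = ≤-antisym (≮⇒≥ x≮fN) (s≤s⁻¹ (subst (x <_) up x<fN+1))

bounded-sum : ∀ {x y a b} → x ≤ a → y ≤ b → x + y ≡ a + b → x ≡ a × y ≡ b
bounded-sum {x} {y} {a} {b} x≤a y≤b sum = x≡a , +-cancelˡ-≡ a y b (subst (λ z → z + y ≡ a + b) x≡a sum)
  where
  x≡a : x ≡ a
  x≡a = ≤-antisym x≤a (≮⇒≥ λ x<a → <⇒≢ (+-mono-<-≤ x<a y≤b) sum)

module _ {m n : ℕ} (B : Matrix m n) where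

  ZeroNE : ℕ → ℕ → Set
  ZeroNE x y = ∀ a b → toℕ a < x → y < toℕ b → B a b ≡ false

  OneNE : ℕ → ℕ → Set
  OneNE x y = Σ (Fin m) λ a → Σ (Fin n) λ b → toℕ a ≤ x × y ≤ toℕ b × B a b ≡ true

  ZeroNE-mono : ∀ {x x' y y'} → x' ≤ x → y ≤ y' → ZeroNE x y → ZeroNE x' y'
  ZeroNE-mono x'≤x y≤y' clear a b a<x' y'<b = clear a b (<-≤-trans a<x' x'≤x) (≤-<-trans y≤y' y'<b)

  OneNE-mono : ∀ {x x' y y'} → x ≤ x' → y' ≤ y → OneNE x y → OneNE x' y'
  OneNE-mono x≤x' y'≤y (a , b , a≤x , y≤b , one) = a , b , ≤-trans a≤x x≤x' , ≤-trans y'≤y y≤b , one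

  oneNE? : ∀ x y → Dec (OneNE x y)
  oneNE? x y = any? λ a → any? λ b → (toℕ a ≤? x) ×-dec (y ≤? toℕ b) ×-dec (B a b Bool.≟ true)

  beyond-last-column : ∀ x y → n ≤ suc y → ZeroNE x y
  beyond-last-column x y n≤1+y a b _ y<b = ⊥-elim (<⇒≱ (toℕ<n b) (≤-trans n≤1+y y<b))

  above-first-row : ∀ y → ZeroNE 0 y
  above-first-row y a b () _

setOne-true : ∀ {m n} (B : Matrix m n) {i a : Fin m} {j b : Fin n} →
  setOne B i j a b ≡ true → (a ≡ i × b ≡ j) ⊎ B a b ≡ true
setOne-true B {i} {a} {j} {b} one with a ≟ i | b ≟ j
... | yes a≡i | yes b≡j = inj₁ (a≡i , b≡j)
... | yes _   | no _    = inj₂ one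
... | no _    | _       = inj₂ one

Hits : ∀ {k' m n} → Matrix m n → (Fin (suc k') → Fin m) → (Fin (suc k') → Fin n) → Fin (suc k') → Set
Hits B rows cols r = B (rows r) (cols (patCol r)) ≡ true

-- An occurrence of the pattern in B except that its corner (the entry of pattern
-- row 0, in the last pattern column) sits at (i,j) and need not be a 1.
CornerAt : ∀ {m n} → (k' : ℕ) → Matrix m n → Fin m → Fin n → Set
CornerAt {m} {n} k' B i j =
  Σ (Fin (suc k') → Fin m) λ rows →
  Σ (Fin (suc k') → Fin n) λ cols →
    StrictlyIncreasing rows × StrictlyIncreasing cols ×
    rows zero ≡ i × cols (fromℕ k') ≡ j × (∀ r → Hits B rows cols (suc r))

below-not-last : ∀ {k'} {r s : Fin (suc k')} → r F.< s → ¬ r ≡ fromℕ k'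
below-not-last {k'} {r} {s} r<s r≡last =
  <⇒≱ (subst (_< toℕ s) (trans (cong toℕ r≡last) (toℕ-fromℕ k')) r<s) (toℕ≤pred[n] s)

-- Moving the corner weakly north-east onto a 1 of B turns a corner-placed
-- occurrence into an occurrence: row 0 moves up, the last column moves right.
shift-corner : ∀ {k' m n} (B : Matrix m n) {i j} → CornerAt k' B i j →
  ∀ a b → toℕ a ≤ toℕ i → toℕ j ≤ toℕ b → B a b ≡ true → ContainsPat k' B
shift-corner {k'} B (rows , cols , rows↑ , cols↑ , refl , refl , hits) a b a≤ ≤b one =
  a ∷ tail rows , cols′ , rows′↑ , cols′↑ , hits′
  where
  cols′ : Fin (suc k') → _
  cols′ = updateAt cols (fromℕ k') (const b)

  cols′-last : cols′ (fromℕ k') ≡ b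
  cols′-last = updateAt-updates (fromℕ k') cols

  cols′-other : ∀ r → ¬ r ≡ fromℕ k' → cols′ r ≡ cols r
  cols′-other r r≢last = updateAt-minimal r (fromℕ k') cols r≢last

  rows′↑ : StrictlyIncreasing (a ∷ tail rows)
  rows′↑ zero    zero    ()
  rows′↑ zero    (suc s) _   = ≤-<-trans a≤ (rows↑ zero (suc s) (s≤s z≤n))
  rows′↑ (suc r) zero    ()
  rows′↑ (suc r) (suc s) r<s = rows↑ (suc r) (suc s) r<s

  cols′↑ : StrictlyIncreasing cols′
  cols′↑ r s r<s with s ≟ fromℕ k'
  ... | yes refl = subst₂ (λ x y → toℕ x < toℕ y) (sym (cols′-other r (below-not-last r<s))) (sym cols′-last)
                     (<-≤-trans (cols↑ r s r<s) ≤b)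
  ... | no s≢last = subst₂ (λ x y → toℕ x < toℕ y) (sym (cols′-other r (below-not-last r<s))) (sym (cols′-other s s≢last))
                     (cols↑ r s r<s)

  hits′ : ∀ r → Hits B (a ∷ tail rows) cols′ r
  hits′ zero    = subst (λ y → B a y ≡ true) (sym cols′-last) one
  hits′ (suc r) = subst (λ y → B (rows (suc r)) y ≡ true)
                    (sym (cols′-other (inject₁ r) (λ eq → fromℕ≢inject₁ (sym eq)))) (hits r)

inject₁<last : ∀ {k'} (r : Fin k') → inject₁ r F.< fromℕ k'
inject₁<last {k'} r = subst (toℕ (inject₁ r) <_) (sym (toℕ-fromℕ k')) (inject₁ℕ< r)

-- If only 0's lie strictly north-east of (i,j), an occurrence of the pattern in
-- `setOne B i j` is either already one in B or has its corner at (i,j): the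
-- new entry cannot be a non-corner entry, since the corner, a 1 of B, would
-- then lie strictly north-east of it.
new-entry-is-corner : ∀ {k' m n} (B : Matrix m n) i j → ZeroNE B (toℕ i) (toℕ j) →
  ContainsPat k' (setOne B i j) → ContainsPat k' B ⊎ CornerAt k' B i j
new-entry-is-corner {k'} B i j clear (rows , cols , rows↑ , cols↑ , hits)
  with setOne-true B (hits zero)
... | inj₁ (corner≡i , corner≡j) = inj₂ (rows , cols , rows↑ , cols↑ , corner≡i , corner≡j , lower-hits)
  where
  lower-hits : ∀ r → Hits B rows cols (suc r)
  lower-hits r with setOne-true B (hits (suc r))
  ... | inj₂ one = one
  ... | inj₁ (row≡i , _) =
    ⊥-elim (<-irrefl (cong toℕ (trans corner≡i (sym row≡i))) (rows↑ zero (suc r) (s≤s z≤n)))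
... | inj₂ corner = inj₁ (rows , cols , rows↑ , cols↑ , old-hits)
  where
  old-hits : ∀ r → Hits B rows cols r
  old-hits zero = corner
  old-hits (suc r) with setOne-true B (hits (suc r))
  ... | inj₂ one = one
  ... | inj₁ (row≡i , col≡j) =
    ⊥-elim (not-¬ corner (clear (rows zero) (cols (fromℕ k')) corner-above corner-right))
    where
    corner-above : toℕ (rows zero) < toℕ i
    corner-above = subst (λ x → toℕ (rows zero) < toℕ x) row≡i (rows↑ zero (suc r) (s≤s z≤n))
    corner-right : toℕ j < toℕ (cols (fromℕ k'))
    corner-right = subst (λ x → toℕ x < toℕ (cols (fromℕ k'))) col≡j
                     (cols↑ (inject₁ r) (fromℕ k') (inject₁<last r))

Anchored : ∀ {m' n} → Matrix (suc m') n → ℕ → ℕ → Set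
Anchored {m'} B x y = OneNE B x y ⊎ y ≡ 0 ⊎ x ≡ m'

-- For a pattern of length at least 2 an anchored corner yields an occurrence:
-- the corner can neither be in the first column (column 0 of the pattern lies
-- left of it) nor in the last row (row 1 of the pattern lies below it).
anchored-corner : ∀ {k m' n} (B : Matrix (suc m') n) {i j} → CornerAt (suc k) B i j →
  Anchored B (toℕ i) (toℕ j) → ContainsPat (suc k) B
anchored-corner B corner (inj₁ (a , b , a≤i , j≤b , one)) = shift-corner B corner a b a≤i j≤b one
anchored-corner {k} B (rows , cols , rows↑ , cols↑ , _ , refl , _) (inj₂ (inj₁ j≡0)) =
  ⊥-elim (<⇒≱ (subst (toℕ (cols zero) <_) j≡0 (cols↑ zero (fromℕ (suc k)) (s≤s z≤n))) z≤n)
anchored-corner B (rows , cols , rows↑ , cols↑ , refl , _ , _) (inj₂ (inj₂ i≡m')) =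
  ⊥-elim (<⇒≱ (subst (_< toℕ (rows (suc zero))) i≡m' (rows↑ zero (suc zero) (s≤s z≤n)))
               (toℕ≤pred[n] (rows (suc zero))))

-- Filling property of maximal avoiders: an anchored position with only 0's
-- strictly north-east of it holds a 1, for otherwise setting it to 1 would
-- create an occurrence, which the two lemmas above transport back into A.
fill : ∀ {k m' n} (A : Matrix (suc m') n) → MaximalAvoiding (suc k) A →
  ∀ i j → ZeroNE A (toℕ i) (toℕ j) → Anchored A (toℕ i) (toℕ j) → A i j ≡ true
fill A (avoids , maximal) i j clear anchored = ¬-not λ Aij≡false →
  maximal i j Aij≡false λ occurrence →
    avoids ([ id , (λ corner → anchored-corner A corner anchored) ]
              (new-entry-is-corner A i j clear occurrence))

module Staircase {m' n' : ℕ} (A : Matrix (suc m') (suc n'))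
  (fill : ∀ i j → ZeroNE A (toℕ i) (toℕ j) → Anchored A (toℕ i) (toℕ j) → A i j ≡ true) where

  Position : Set
  Position = Fin (suc m') × Fin (suc n')

  rowNo colNo : Position → ℕ
  rowNo p = toℕ (proj₁ p)
  colNo p = toℕ (proj₂ p)

  bottom-right-one : A (fromℕ m') (fromℕ n') ≡ true
  bottom-right-one = fill (fromℕ m') (fromℕ n')
    (beyond-last-column A _ _ (s≤s (≤-reflexive (sym (toℕ-fromℕ n')))))
    (inj₂ (inj₂ (toℕ-fromℕ m')))

  data Move (p q : Position) : Set where
    right : rowNo q ≡ rowNo p → colNo q ≡ suc (colNo p) →
            OneNE A (rowNo p) (suc (colNo p)) → Move p q
    down  : rowNo q ≡ suc (rowNo p) → colNo q ≡ colNo p →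
            ZeroNE A (suc (rowNo p)) (colNo p) → Move p q
    stay  : rowNo p ≡ m' → colNo p ≡ n' → q ≡ p → Move p q

  -- Leaving a cleared position: down, unless in the last row, where clearedness
  -- and the 1 in the bottom-right corner force the position to be that corner.
  descend : (p : Position) → ZeroNE A (suc (rowNo p)) (colNo p) → Σ Position (Move p)
  descend (r , c) clear with toℕ r <? m'
  ... | yes r<m' = (fromℕ< (s≤s r<m') , c) , down (toℕ-fromℕ< (s≤s r<m')) refl clear
  ... | no r≮m' = (r , c) , stay r≡m' c≡n' refl
    where
    r≡m' : toℕ r ≡ m'
    r≡m' = ≤-antisym (toℕ≤pred[n] r) (≮⇒≥ r≮m')
    c≡n' : toℕ c ≡ n'
    c≡n' = ≤-antisym (toℕ≤pred[n] c) (≮⇒≥ λ c<n' → not-¬ bottom-right-one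
             (clear (fromℕ m') (fromℕ n') (s≤s (≤-reflexive (trans (toℕ-fromℕ m') (sym r≡m'))))
                    (subst (toℕ c <_) (sym (toℕ-fromℕ n')) c<n')))

  step : (p : Position) → Σ Position (Move p)
  step (r , c) with toℕ c <? n'
  ... | no c≮n' = descend (r , c) (beyond-last-column A _ _ (s≤s (≮⇒≥ c≮n')))
  ... | yes c<n' with oneNE? A (toℕ r) (suc (toℕ c))
  ...   | yes one = (r , fromℕ< (s≤s c<n')) , right refl (toℕ-fromℕ< (s≤s c<n')) one
  ...   | no none = descend (r , c) λ a b a≤r c<b →
                      ¬-not λ one → none (a , b , s≤s⁻¹ a≤r , c<b , one)

  walk : ℕ → Position
  walk zero    = zero , zero
  walk (suc t) = proj₁ (step (walk t))

  move : ∀ t → Move (walk t) (walk (suc t))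
  move t = proj₂ (step (walk t))

  Good : Position → Set
  Good p = A (proj₁ p) (proj₂ p) ≡ true × ZeroNE A (rowNo p) (colNo p)

  fill-at : (p : Position) → ZeroNE A (rowNo p) (colNo p) → Anchored A (rowNo p) (colNo p) → Good p
  fill-at p clear anchored = fill (proj₁ p) (proj₂ p) clear anchored , clear

  move-preserves-good : ∀ {p q} → Move p q → Good p → Good q
  move-preserves-good {p} {q} (right same next one) (_ , clear) =
    fill-at q (ZeroNE-mono A (≤-reflexive same) (subst (colNo p ≤_) (sym next) (n≤1+n _)) clear)
              (inj₁ (OneNE-mono A (≤-reflexive (sym same)) (≤-reflexive next) one))
  move-preserves-good {p} {q} (down below same clear) (p-one , _) =
    fill-at q (ZeroNE-mono A (≤-reflexive below) (≤-reflexive (sym same)) clear)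
              (inj₁ (proj₁ p , proj₂ p , subst (rowNo p ≤_) (sym below) (n≤1+n _) , ≤-reflexive same , p-one))
  move-preserves-good (stay _ _ q≡p) good = subst Good (sym q≡p) good

  good : ∀ t → Good (walk t)
  good zero    = fill-at (zero , zero) (above-first-row A 0) (inj₂ (inj₁ refl))
  good (suc t) = move-preserves-good (move t) (good t)

  N : ℕ
  N = m' + n'

  I J : ℕ → ℕ
  I t = rowNo (walk t)
  J t = colNo (walk t)

  Adjacent : Position → Position → Set
  Adjacent p q = (rowNo q ≡ rowNo p × colNo q ≡ suc (colNo p))
               ⊎ (rowNo q ≡ suc (rowNo p) × colNo q ≡ colNo p)

  adjacent-sum : ∀ {p q} → Adjacent p q → rowNo q + colNo q ≡ suc (rowNo p + colNo p)
  adjacent-sum {p} (inj₁ (same , next)) = trans (cong₂ _+_ same next) (+-suc (rowNo p) (colNo p))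
  adjacent-sum     (inj₂ (below , same)) = cong₂ _+_ below same

  advance-or-end : ∀ {p q} → Move p q → Adjacent p q ⊎ rowNo p + colNo p ≡ N
  advance-or-end (right same next _) = inj₁ (inj₁ (same , next))
  advance-or-end (down below same _) = inj₁ (inj₂ (below , same))
  advance-or-end (stay r≡m' c≡n' _)  = inj₂ (cong₂ _+_ r≡m' c≡n')

  antidiagonal : ∀ t → t ≤ N → I t + J t ≡ t
  antidiagonal zero    _     = refl
  antidiagonal (suc t) 1+t≤N with advance-or-end (move t)
  ... | inj₁ adjacent = trans (adjacent-sum adjacent) (cong suc (antidiagonal t (<⇒≤ 1+t≤N)))
  ... | inj₂ at-end   = ⊥-elim (<⇒≢ 1+t≤N (trans (sym (antidiagonal t (<⇒≤ 1+t≤N))) at-end))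

  advances : ∀ t → t < N → Adjacent (walk t) (walk (suc t))
  advances t t<N with advance-or-end (move t)
  ... | inj₁ adjacent = adjacent
  ... | inj₂ at-end   = ⊥-elim (<⇒≢ t<N (trans (sym (antidiagonal t (<⇒≤ t<N))) at-end))

  end-coordinates : I N ≡ m' × J N ≡ n'
  end-coordinates = bounded-sum (toℕ≤pred[n] (proj₁ (walk N))) (toℕ≤pred[n] (proj₂ (walk N)))
                                (antidiagonal N ≤-refl)

  walk-end : walk N ≡ (fromℕ m' , fromℕ n')
  walk-end = cong₂ _,_ (toℕ-injective (trans (proj₁ end-coordinates) (sym (toℕ-fromℕ m'))))
                       (toℕ-injective (trans (proj₂ end-coordinates) (sym (toℕ-fromℕ n'))))

  row-steps : ∀ t → I (suc t) ≡ I t ⊎ I (suc t) ≡ suc (I t)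
  row-steps t with move t
  ... | right same _ _ = inj₁ same
  ... | down below _ _ = inj₂ below
  ... | stay _ _ q≡p   = inj₁ (cong rowNo q≡p)

  path : Path m' n'
  path t = walk (toℕ t)

  path-zigzag : IsZigzag path
  path-zigzag = refl , trans (cong walk (toℕ-fromℕ N)) walk-end , λ t →
    subst (λ u → Adjacent (walk u) (walk (suc (toℕ t)))) (sym (toℕ-inject₁ t))
          (advances (toℕ t) (toℕ<n t))

  path-ones : ∀ t → A (proj₁ (path t)) (proj₂ (path t)) ≡ true
  path-ones t = proj₁ (good (toℕ t))

  left-of : ∀ {a b} → AbovePath path a b → ∀ u → u ≤ N → I u ≡ toℕ a → J u < toℕ b
  left-of {a} {b} above u u≤N Iu≡a =
    subst (λ s → J s < toℕ b) time≡u (above time (toℕ-injective (trans (cong I time≡u) Iu≡a)))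
    where
    time : Fin (suc N)
    time = fromℕ< (s≤s u≤N)
    time≡u : toℕ time ≡ u
    time≡u = toℕ-fromℕ< (s≤s u≤N)

  -- Positions above the path are 0: in the last row there are none, and any
  -- other row a is left by a down-step from a column left of b, which certifies
  -- that row a is 0 right of that column.
  above-zero : ∀ a b → AbovePath path a b → A a b ≡ false
  above-zero a b above with toℕ a <? m'
  ... | no a≮m' = ⊥-elim (<⇒≱ (subst (_< toℕ b) (proj₂ end-coordinates) (left-of above N ≤-refl IN≡a))
                              (toℕ≤pred[n] b))
    where
    IN≡a : I N ≡ toℕ a
    IN≡a = trans (proj₁ end-coordinates) (≤-antisym (≮⇒≥ a≮m') (toℕ≤pred[n] a))
  ... | yes a<m' with up-crossing I row-steps N (toℕ a) z≤n (subst (toℕ a <_) (sym (proj₁ end-coordinates)) a<m')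
  ...   | u , u<N , Iu≡a , leaves = leaving (move u)
    where
    stays-in-row : I (suc u) ≡ I u → A a b ≡ false
    stays-in-row same = ⊥-elim (1+n≢n (trans (sym leaves) (trans same Iu≡a)))
    leaving : Move (walk u) (walk (suc u)) → A a b ≡ false
    leaving (down _ _ clear) = clear a b (s≤s (≤-reflexive (sym Iu≡a))) (left-of above u (<⇒≤ u<N) Iu≡a)
    leaving (right same _ _) = stays-in-row same
    leaving (stay _ _ q≡p)   = stays-in-row (cong rowNo q≡p)

-- The theorem.
lemma3p3 : (k' m' n' : ℕ) → 2 ≤ k' →
    (A : Matrix (suc m') (suc n')) →
    MaximalAvoiding k' A →
    A zero (fromℕ n') ≡ false →
    Σ (Path m' n') λ p →
    IsZigzag p ×
    (∀ t → A (proj₁ (p t)) (proj₂ (p t)) ≡ true) ×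
    (∀ i j → AbovePath p i j → A i j ≡ false)
lemma3p3 (suc k) m' n' _ A maximal _ = path , path-zigzag , path-ones , above-zero
  where open Staircase A (fill A maximal)
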